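{- Let $F_0$ be the value of a $\beta$-approximate solution for $k$-center with a mergeable constraint on an instance $(P,d,k)$, and let $r_1^*$ be the largest radius of an optimal $k$-min-sum-radii solution with the same constraint on the same instance. Then $r_1^*\in\left[\frac{F_0}{\beta},\,kF_0\right]$.
   Context: Solutions consist of at most $k$ centers $\mathscr{C}\subseteq P$ and an assignment $\sigma\colon P\to\mathscr{C}$; the radius of cluster $\sigma^{ -1}(c)$ is $\max_{p\in\sigma^{ -1}(c)}d(p,c)$. A constraint is a predicate on clusterings; it is mergeable if feasibility is preserved when two clusters are united and assigned to an arbitrary point of their union. Constrained $k$-center minimizes the maximum radius over feasible solutions; constrained $k$-min-sum-radii minimizes the sum of radii over feasible solutions. A $\beta$-approximate solution has value at most $\beta$ times the optimum.
   Formalization: The distances d and the approximation factor β are rational. -}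

module Defs where

open import Data.Nat using (ℕ) renaming (_≤_ to _≤ℕ_)
open import Data.Fin using (Fin; _≟_)
open import Data.Fin.Subset using (Subset; _∈_; _∪_; _∩_; ∁; ⁅_⁆; ∣_∣)
open import Data.List using (List; foldr)
open import Data.Vec using (lookup)
open import Data.List.Base using ()
open import Data.Fin.Base using ()
open import Data.Bool using (Bool; if_then_else_; _∨_)
open import Data.Rational using (ℚ; 0ℚ; _≤_; _+_; _⊔_)
open import Data.Product using (_×_)
open import Data.Sum using (_⊎_)
open import Relation.Nullary using (¬_)
open import Relation.Nullary.Decidable using (⌊_⌋)
open import Relation.Binary.PropositionalEquality using (_≡_)
import Data.List as L

points : (n : ℕ) → List (Fin n)
points n = L.allFin n

record IsMetric (n : ℕ) (d : Fin n → Fin n → ℚ) : Set where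
  field
    nonneg   : ∀ p q → 0ℚ ≤ d p q
    zero-iff : ∀ p q → d p q ≡ 0ℚ → p ≡ q
    refl0    : ∀ p → d p p ≡ 0ℚ
    symm     : ∀ p q → d p q ≡ d q p
    triangle : ∀ p q r → d p r ≤ d p q + d q r

record Clustering (n : ℕ) : Set where
  constructor clustering
  field
    centers : Subset n
    assign  : Fin n → Fin n
open Clustering public

Valid : {n : ℕ} → ℕ → Clustering n → Set
Valid k S = ∣ centers S ∣ ≤ℕ k × (∀ p → assign S p ∈ centers S)

Constraint : ℕ → Set₁
Constraint n = Clustering n → Set

Feasible : {n : ℕ} → Constraint n → ℕ → Clustering n → Set
Feasible Γ k S = Valid k S × Γ S

-- radius of cluster σ⁻¹(c): max_{p ∈ σ⁻¹(c)} d(p,c)  (0 for an empty cluster)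
radius : {n : ℕ} → (Fin n → Fin n → ℚ) → Clustering n → Fin n → ℚ
radius {n} d S c =
  foldr (λ p acc → if ⌊ assign S p ≟ c ⌋ then d p c ⊔ acc else acc) 0ℚ (points n)

maxRadius : {n : ℕ} → (Fin n → Fin n → ℚ) → Clustering n → ℚ
maxRadius {n} d S =
  foldr (λ c acc → if lookup (centers S) c then radius d S c ⊔ acc else acc) 0ℚ (points n)

sumRadii : {n : ℕ} → (Fin n → Fin n → ℚ) → Clustering n → ℚ
sumRadii {n} d S =
  foldr (λ c acc → if lookup (centers S) c then radius d S c + acc else acc) 0ℚ (points n)

merge : {n : ℕ} → Clustering n → Fin n → Fin n → Fin n → Clustering n
merge {n} S c₁ c₂ c = clustering C' σ'
  where
    C' : Subset n
    C' = ((centers S ∩ ∁ ⁅ c₁ ⁆) ∩ ∁ ⁅ c₂ ⁆) ∪ ⁅ c ⁆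
    σ' : Fin n → Fin n
    σ' p = if ⌊ assign S p ≟ c₁ ⌋ ∨ ⌊ assign S p ≟ c₂ ⌋ then c else assign S p

Mergeable : {n : ℕ} → Constraint n → Set
Mergeable {n} Γ =
  ∀ (S : Clustering n) (c₁ c₂ c : Fin n) →
  (∀ p → assign S p ∈ centers S) →
  c₁ ∈ centers S → c₂ ∈ centers S → ¬ (c₁ ≡ c₂) →
  (assign S c ≡ c₁ ⊎ assign S c ≡ c₂) →
  Γ S → Γ (merge S c₁ c₂ c)

IsApproxKCenter : {n : ℕ} → (Fin n → Fin n → ℚ) → Constraint n → ℕ → ℚ → Clustering n → Set
IsApproxKCenter {n} d Γ k β S =
  Feasible Γ k S × (∀ T → Feasible Γ k T → maxRadius d S ≤ β Data.Rational.* maxRadius d T)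

IsOptimalMSR : {n : ℕ} → (Fin n → Fin n → ℚ) → Constraint n → ℕ → Clustering n → Set
IsOptimalMSR {n} d Γ k O =
  Feasible Γ k O × (∀ T → Feasible Γ k T → sumRadii d O ≤ sumRadii d T)

{-# OPTIONS --safe #-}
module Submission where

-- The MSR optimum O is a feasible k-center solution, so β-approximation gives
-- F₀ ≤ β · r₁*. Conversely S is a feasible MSR solution, so
-- r₁* ≤ (sum of the radii of O) ≤ (sum of the radii of S) ≤ |centers S| · F₀ ≤ k · F₀.

open import Defs
open import Data.Nat using (ℕ)
open import Data.Fin using (Fin)
open import Data.Integer using (+_)
open import Data.Rational using (ℚ; 0ℚ; _≤_; _<_; _*_; _÷_; _/_; NonZero)
open import Data.Product using (_×_)

open import Data.Bool using (Bool; true; false; if_then_else_)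
open import Data.Fin using (zero; suc)
open import Data.Fin.Subset using (∣_∣)
import Data.Integer as ℤ
import Data.Integer.Properties as ℤ
open import Data.List using (List; []; _∷_; foldr; length; filterᵇ; tabulate)
import Data.Nat as ℕ
import Data.Nat.Coprimality as Coprimality
open import Data.Product using (_,_; proj₁)
open import Data.Rational using (*≤*; mkℚ; 1ℚ; _+_; _⊔_; 1/_; positive; nonNegative)
open import Data.Rational.Properties
import Data.Rational.Unnormalised as ℚᵘ
import Data.Rational.Unnormalised.Properties as ℚᵘ
open import Data.Vec using (Vec; []; _∷_; lookup)
open import Function using (id)
open import Relation.Binary.PropositionalEquality using (_≡_; refl; sym; cong)

-- (+ m) / 1 goes through a gcd and does not compute for variable m; its normal form does.
fromℕ : ℕ → ℚ
fromℕ m = mkℚ (+ m) 0 (Coprimality.sym (Coprimality.1-coprimeTo m))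

fromℕ≡+m/1 : ∀ m → fromℕ m ≡ (+ m) / 1
fromℕ≡+m/1 m = sym (↥p/↧p≡p (fromℕ m))

fromℕ-suc : ∀ m → fromℕ (ℕ.suc m) ≡ 1ℚ + fromℕ m
fromℕ-suc m = toℚᵘ-injective (ℚᵘ.≃-trans (ℚᵘ.*≡* numerators) (ℚᵘ.≃-sym (toℚᵘ-homo-+ 1ℚ (fromℕ m))))
  where
  numerators : (+ 1 ℤ.+ + m) ℤ.* + 1 ≡ (+ 1 ℤ.+ + m ℤ.* + 1) ℤ.* + 1
  numerators = cong (λ x → (+ 1 ℤ.+ x) ℤ.* + 1) (sym (ℤ.*-identityʳ (+ m)))

fromℕ-mono-≤ : ∀ {m n} → m ℕ.≤ n → fromℕ m ≤ fromℕ n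
fromℕ-mono-≤ m≤n = *≤* (ℤ.*-monoʳ-≤-nonNeg (+ 1) (ℤ.+≤+ m≤n))

p≤r*q⇒p÷r≤q : ∀ {p q} r .{{_ : NonZero r}} → 0ℚ < r → p ≤ r * q → p ÷ r ≤ q
p≤r*q⇒p÷r≤q {p} {q} r 0<r p≤r*q = *-cancelʳ-≤-pos r {{positive 0<r}} (begin
  p * 1/ r * r    ≡⟨ *-assoc p (1/ r) r ⟩
  p * (1/ r * r)  ≡⟨ cong (p *_) (*-inverseˡ r) ⟩
  p * 1ℚ          ≡⟨ *-identityʳ p ⟩
  p               ≤⟨ p≤r*q ⟩
  r * q           ≡⟨ *-comm r q ⟩
  q * r           ∎)
  where open ≤-Reasoning

p≤p+q : ∀ p {q} → 0ℚ ≤ q → p ≤ p + q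
p≤p+q p 0≤q = ≤-trans (≤-reflexive (sym (+-identityʳ p))) (+-monoʳ-≤ p 0≤q)

p≤q+p : ∀ p {q} → 0ℚ ≤ q → p ≤ q + p
p≤q+p p 0≤q = ≤-trans (≤-reflexive (sym (+-identityˡ p))) (+-monoˡ-≤ p 0≤q)

-- radius, maxRadius and sumRadii are, definitionally, instances of these two folds.
module _ {A : Set} (selected : A → Bool) (f : A → ℚ) where

  selectedMax : List A → ℚ
  selectedMax = foldr (λ a acc → if selected a then f a ⊔ acc else acc) 0ℚ

  selectedSum : List A → ℚ
  selectedSum = foldr (λ a acc → if selected a then f a + acc else acc) 0ℚ

  selectedMax-nonNeg : ∀ xs → 0ℚ ≤ selectedMax xs
  selectedMax-nonNeg [] = ≤-refl
  selectedMax-nonNeg (x ∷ xs) with selected x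
  ... | true  = ≤-trans (selectedMax-nonNeg xs) (p≤q⊔p (f x) _)
  ... | false = selectedMax-nonNeg xs

  module _ (f-nonNeg : ∀ a → 0ℚ ≤ f a) where

    selectedSum-nonNeg : ∀ xs → 0ℚ ≤ selectedSum xs
    selectedSum-nonNeg [] = ≤-refl
    selectedSum-nonNeg (x ∷ xs) with selected x
    ... | true  = +-mono-≤ (f-nonNeg x) (selectedSum-nonNeg xs)
    ... | false = selectedSum-nonNeg xs

    selectedMax≤selectedSum : ∀ xs → selectedMax xs ≤ selectedSum xs
    selectedMax≤selectedSum [] = ≤-refl
    selectedMax≤selectedSum (x ∷ xs) with selected x
    ... | true  = ⊔-lub (p≤p+q (f x) (selectedSum-nonNeg xs))
                        (≤-trans (selectedMax≤selectedSum xs) (p≤q+p (selectedSum xs) (f-nonNeg x)))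
    ... | false = selectedMax≤selectedSum xs

  selectedSum≤count*selectedMax : ∀ xs →
    selectedSum xs ≤ fromℕ (length (filterᵇ selected xs)) * selectedMax xs
  selectedSum≤count*selectedMax [] = ≤-reflexive (sym (*-zeroˡ 0ℚ))
  selectedSum≤count*selectedMax (x ∷ xs) with selected x
  ... | true = begin
    f x + selectedSum xs    ≤⟨ +-mono-≤ (p≤p⊔q (f x) m)
                                 (≤-trans (selectedSum≤count*selectedMax xs)
                                          (*-monoˡ-≤-nonNeg (fromℕ c) (p≤q⊔p (f x) m))) ⟩
    M + fromℕ c * M         ≡⟨ cong (_+ fromℕ c * M) (sym (*-identityˡ M)) ⟩
    1ℚ * M + fromℕ c * M    ≡⟨ sym (*-distribʳ-+ M 1ℚ (fromℕ c)) ⟩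
    (1ℚ + fromℕ c) * M      ≡⟨ cong (_* M) (sym (fromℕ-suc c)) ⟩
    fromℕ (ℕ.suc c) * M     ∎
    where
    open ≤-Reasoning
    c : ℕ
    c = length (filterᵇ selected xs)
    m M : ℚ
    m = selectedMax xs
    M = f x ⊔ m
  ... | false = selectedSum≤count*selectedMax xs

length-filterᵇ-tabulate : ∀ {A : Set} {n} (v : Vec Bool n) (selected : A → Bool) (h : Fin n → A) →
  (∀ i → selected (h i) ≡ lookup v i) → length (filterᵇ selected (tabulate h)) ≡ ∣ v ∣
length-filterᵇ-tabulate [] _ _ _ = refl
length-filterᵇ-tabulate (true ∷ v) selected h selected∘h≗v rewrite selected∘h≗v zero =
  cong ℕ.suc (length-filterᵇ-tabulate v selected (λ i → h (suc i)) (λ i → selected∘h≗v (suc i)))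
length-filterᵇ-tabulate (false ∷ v) selected h selected∘h≗v rewrite selected∘h≗v zero =
  length-filterᵇ-tabulate v selected (λ i → h (suc i)) (λ i → selected∘h≗v (suc i))

module _ {n : ℕ} (d : Fin n → Fin n → ℚ) (S : Clustering n) where

  radius-nonNeg : ∀ c → 0ℚ ≤ radius d S c
  radius-nonNeg c = selectedMax-nonNeg _ (λ p → d p c) (points n)

  maxRadius-nonNeg : 0ℚ ≤ maxRadius d S
  maxRadius-nonNeg = selectedMax-nonNeg (lookup (centers S)) (radius d S) (points n)

  maxRadius≤sumRadii : maxRadius d S ≤ sumRadii d S
  maxRadius≤sumRadii = selectedMax≤selectedSum (lookup (centers S)) (radius d S) radius-nonNeg (points n)

  sumRadii≤∣centers∣*maxRadius : sumRadii d S ≤ fromℕ ∣ centers S ∣ * maxRadius d S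
  sumRadii≤∣centers∣*maxRadius
    rewrite sym (length-filterᵇ-tabulate (centers S) (lookup (centers S)) id (λ _ → refl)) =
    selectedSum≤count*selectedMax (lookup (centers S)) (radius d S) (points n)

lemma15 : (n k : ℕ) (d : Fin n → Fin n → ℚ) → IsMetric n d →
    (Γ : Constraint n) → Mergeable Γ →
    (β : ℚ) .{{_ : NonZero β}} → 0ℚ < β →
    (S : Clustering n) → IsApproxKCenter d Γ k β S →
    (O : Clustering n) → IsOptimalMSR d Γ k O →
    (maxRadius d S ÷ β ≤ maxRadius d O) × (maxRadius d O ≤ ((+ k) / 1) * maxRadius d S)
lemma15 n k d _ _ _ β 0<β S (S-feasible , S-approx) O (O-feasible , O-optimal) =
  p≤r*q⇒p÷r≤q β 0<β (S-approx O O-feasible) , (begin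
    maxRadius d O                        ≤⟨ maxRadius≤sumRadii d O ⟩
    sumRadii d O                         ≤⟨ O-optimal S S-feasible ⟩
    sumRadii d S                         ≤⟨ sumRadii≤∣centers∣*maxRadius d S ⟩
    fromℕ ∣ centers S ∣ * maxRadius d S  ≤⟨ *-monoʳ-≤-nonNeg (maxRadius d S) {{nonNegative (maxRadius-nonNeg d S)}}
                                              (fromℕ-mono-≤ (proj₁ (proj₁ S-feasible))) ⟩
    fromℕ k * maxRadius d S              ≡⟨ cong (_* maxRadius d S) (fromℕ≡+m/1 k) ⟩
    (+ k) / 1 * maxRadius d S            ∎)
  where open ≤-Reasoning
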